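{- Let $G_1,G_2$ be subgroups of an abelian group $\mathcal{G}$ (written multiplicatively) such that $G_2$ is a finitely generated free abelian group of positive rank $r$ and the homomorphism $G_1\times G_2\to\mathcal{G}$, $(g_1,g_2)\mapsto g_1g_2$, is injective. Let $u:G_1\to G_2$ be a function, $\varphi:G_2\to\mathbb{Z}^r$ an isomorphism, $\mathcal{B}\subseteq G_1$ non-empty, and let $X$ be a $(u,\varphi)$-bounded spiked subset of $\mathcal{G}$ with respect to $G_1,G_2$ with base $\mathcal{B}$. Suppose $u$ admits a $\varphi$-moderation. Then the following are equivalent: (i) there exist a $\varphi$-moderation $v$ of $u$ and a subset $M\subseteq G_1$ such that $(X,M_v)$ is a co-minimal pair in $G_1G_2$, where $M_v=\{m\,v(m): m\in M\}$ is the graph of $v|_M$; (ii) $X=\mathcal{B}G_2$ and $\mathcal{B}$ is part of a co-minimal pair in $G_1$.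
   Context: For $y\in\mathbb{Z}^r$, $\mathbb{Z}^r_{<y}$ denotes the set of $x\in\mathbb{Z}^r$ with $x_i<y_i$ for every coordinate $i$. A subset $X\subseteq\mathcal{G}$ is a $(u,\varphi)$-bounded spiked subset with respect to $G_1,G_2$ with base $\mathcal{B}$ if $$\mathcal{B}G_2\subseteq X\subseteq \mathcal{B}G_2\ \sqcup\ \bigsqcup_{g_1\in G_1\setminus\mathcal{B}} g_1\cdot\varphi^{ -1}\big(\mathbb{Z}^r_{<\varphi(u(g_1))}\big).$$ A function $v:G_1\to G_2$ is a $\varphi$-moderation of $u$ if for every $g_0\in G_1$ the function $G_1\to\mathbb{Z}^r$, $g\mapsto \varphi(u(g))+\varphi(v(g_0g^{ -1}))$, is bounded above (in each coordinate). For non-empty subsets $A,B$ of an abelian group $H$, $(A,B)$ is a co-minimal pair if $AB=H$, $(A\setminus\{a\})B\neq H$ for all $a\in A$, and $A(B\setminus\{b\})\neq H$ for all $b\in B$; a set is part of a co-minimal pair if it is one entry of some co-minimal pair. -}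

module Defs where

open import Level using (Level; _⊔_)
open import Algebra.Bundles using (AbelianGroup)
open import Data.Nat using (ℕ)
open import Data.Integer using (ℤ; _+_; _<_; _≤_)
open import Data.Vec using (Vec; zipWith)
open import Data.Vec.Relation.Binary.Pointwise.Inductive using (Pointwise)
open import Data.Product using (Σ; ∃; ∃-syntax; _×_)
open import Data.Sum using (_⊎_)
open import Relation.Nullary using (¬_)
open import Relation.Unary using (Pred; _⊆_; _≐_)
open import Relation.Binary.PropositionalEquality using (_≡_)

_+ᵛ_ : ∀ {r} → Vec ℤ r → Vec ℤ r → Vec ℤ r
_+ᵛ_ = zipWith _+_

_<ᵛ_ : ∀ {r} → Vec ℤ r → Vec ℤ r → Set
_<ᵛ_ = Pointwise _<_

_≤ᵛ_ : ∀ {r} → Vec ℤ r → Vec ℤ r → Set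
_≤ᵛ_ = Pointwise _≤_

module GroupDefs {c ℓ : Level} (𝒢 : AbelianGroup c ℓ) where
  open AbelianGroup 𝒢 public

  Subset : Set _
  Subset = Pred Carrier (c ⊔ ℓ)

  Closed : Subset → Set _
  Closed A = ∀ {x y} → x ≈ y → A x → A y

  SubsetOf : Subset → Subset → Set _
  SubsetOf H A = Closed A × (A ⊆ H)

  NonEmpty : Subset → Set _
  NonEmpty A = ∃[ a ] A a

  IsSubgroup : Subset → Set _
  IsSubgroup H = Closed H × H ε × (∀ {x y} → H x → H y → H (x ∙ y))
                 × (∀ {x} → H x → H (x ⁻¹))

  _·_ : Subset → Subset → Subset
  (A · B) x = ∃[ a ] ∃[ b ] A a × B b × x ≈ a ∙ b

  _∖⟨_⟩ : Subset → Carrier → Subset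
  (A ∖⟨ a ⟩) x = A x × ¬ (x ≈ a)

  CoMinimalPair : Subset → Subset → Subset → Set _
  CoMinimalPair H A B =
    SubsetOf H A × SubsetOf H B × NonEmpty A × NonEmpty B ×
    ((A · B) ≐ H) ×
    (∀ a → A a → ¬ (((A ∖⟨ a ⟩) · B) ≐ H)) ×
    (∀ b → B b → ¬ ((A · (B ∖⟨ b ⟩)) ≐ H))

  PartOfCoMinimalPair : Subset → Subset → Set _
  PartOfCoMinimalPair H A =
    ∃[ C ] SubsetOf H C × (CoMinimalPair H A C ⊎ CoMinimalPair H C A)

  -- f is a (well-defined) function from the subgroup H to the subgroup K;
  -- its values outside H are irrelevant.
  MapBetween : Subset → Subset → (Carrier → Carrier) → Set _
  MapBetween H K f = (∀ {x} → H x → K (f x))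
                   × (∀ {x y} → H x → H y → x ≈ y → f x ≈ f y)

  -- φ : K → ℤ^r is a group isomorphism (values outside K irrelevant)
  IsIsoToℤ^ : (r : ℕ) → Subset → (Carrier → Vec ℤ r) → Set _
  IsIsoToℤ^ r K φ =
    (∀ {x y} → K x → K y → x ≈ y → φ x ≡ φ y) ×
    (∀ {x y} → K x → K y → φ (x ∙ y) ≡ φ x +ᵛ φ y) ×
    (∀ {x y} → K x → K y → φ x ≡ φ y → x ≈ y) ×
    (∀ z → ∃[ x ] K x × φ x ≡ z)

  ProductInjective : Subset → Subset → Set _
  ProductInjective G₁ G₂ =
    ∀ {a a′ b b′} → G₁ a → G₁ a′ → G₂ b → G₂ b′ →
      a ∙ b ≈ a′ ∙ b′ → (a ≈ a′) × (b ≈ b′)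

  -- the "spikes":  ⊔_{g₁ ∈ G₁ \ B} g₁ · φ⁻¹(ℤ^r_{< φ(u(g₁))})
  Spikes : ∀ {r} → Subset → Subset → (Carrier → Carrier) → (Carrier → Vec ℤ r)
           → Subset → Subset
  Spikes G₁ G₂ u φ B x =
    ∃[ g₁ ] ∃[ h ] G₁ g₁ × ¬ B g₁ × G₂ h × (φ h <ᵛ φ (u g₁)) × x ≈ g₁ ∙ h

  BoundedSpikedSubset : ∀ {r} → Subset → Subset → (Carrier → Carrier)
                        → (Carrier → Vec ℤ r) → Subset → Subset → Set _
  BoundedSpikedSubset G₁ G₂ u φ B X =
    Closed X × ((B · G₂) ⊆ X) ×
    (X ⊆ λ x → (B · G₂) x ⊎ Spikes G₁ G₂ u φ B x)

  Moderation : ∀ {r} → Subset → (Carrier → Vec ℤ r) → (Carrier → Carrier)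
               → (Carrier → Carrier) → Set _
  Moderation G₁ φ u v =
    ∀ g₀ → G₁ g₀ → ∃[ C ] ∀ g → G₁ g → (φ (u g) +ᵛ φ (v (g₀ ∙ g ⁻¹))) ≤ᵛ C

  Graph : Subset → (Carrier → Carrier) → Subset
  Graph M v x = ∃[ m ] M m × x ≈ m ∙ v m

-- Because G₁ × G₂ → G₁G₂ is injective, replacing B ⊆ G₁ by BG₂ and C ⊆ G₁ by the graph
-- Cᵥ = {c v(c)} of any v : G₁ → G₂ turns co-minimal pairs (B, C) in G₁ into co-minimal
-- pairs (BG₂, Cᵥ) in G₁G₂ and back; the covering transfers via gk = (b · k v(c)⁻¹)(c v(c))
-- for g = bc.  It remains to see that a co-minimal partner Mᵥ of the spiked set X, with v
-- a moderation, forces X = BG₂.  Given g ∈ G₁, pick k ∈ G₂ with φ(k) the moderation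
-- bound of v at g.  If gk = (g₁h)(m v(m)) with g₁h a spike, then m = g g₁⁻¹ and
-- φ(k) = φ(h) + φ(v(g g₁⁻¹)) < φ(u(g₁)) + φ(v(g g₁⁻¹)) ≤ φ(k) coordinatewise, absurd as
-- r > 0.  So BM = G₁, hence BG₂ alone already covers G₁G₂ together with Mᵥ, and
-- minimality of X excludes every spike.
module Submission where

open import Defs
open import Level using (Level)
open import Algebra.Bundles using (AbelianGroup; Group)
open import Data.Nat using (ℕ; _<_; suc)
open import Data.Integer using (ℤ)
import Data.Integer.Properties as ℤ
open import Data.Vec using (Vec; []; _∷_)
open import Data.Vec.Relation.Binary.Pointwise.Inductive using ([]; _∷_)
open import Data.Product using (∃-syntax; _×_; _,_; proj₁; proj₂)
open import Data.Sum using (_⊎_; inj₁; inj₂)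
open import Data.Empty using (⊥-elim)
open import Relation.Nullary using (¬_)
open import Function.Bundles using (_⇔_; mk⇔; Equivalence)
open import Relation.Unary using (_⊆_; _≐_)
open import Relation.Unary.Properties using (≐-sym)
open import Function.Base using (id)
open import Relation.Binary.PropositionalEquality as ≡ using (_≡_)

+ᵛ-<ᵛ-≤ᵛ-trans : ∀ {r} {a b c d : Vec ℤ r} → a <ᵛ c → (c +ᵛ b) ≤ᵛ d → (a +ᵛ b) <ᵛ d
+ᵛ-<ᵛ-≤ᵛ-trans {b = []} [] [] = []
+ᵛ-<ᵛ-≤ᵛ-trans {b = y ∷ _} (a<c ∷ as<cs) (c+y≤d ∷ cs+ys≤ds) =
  ℤ.<-≤-trans (ℤ.+-monoˡ-< y a<c) c+y≤d ∷ +ᵛ-<ᵛ-≤ᵛ-trans as<cs cs+ys≤ds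

<ᵛ-irrefl : ∀ {r} {d : Vec ℤ (suc r)} → ¬ (d <ᵛ d)
<ᵛ-irrefl (d<d ∷ _) = ℤ.<-irrefl ≡.refl d<d

module _ {c ℓ : Level} (𝒢 : AbelianGroup c ℓ) where
  open GroupDefs 𝒢
  open Group group using (_//_)
  open import Algebra.Properties.AbelianGroup 𝒢
    using (x≈z//y; ∙-cancelʳ; //-rightDividesˡ; ⁻¹-∙-comm)
  open import Algebra.Properties.CommutativeSemigroup commutativeSemigroup using (interchange)
  open import Relation.Binary.Reasoning.Setoid setoid

  module Subgroup {H : Subset} (H-sub : IsSubgroup H) where
    ≈-closed : Closed H
    ≈-closed = proj₁ H-sub

    ε-closed : H ε
    ε-closed = proj₁ (proj₂ H-sub)

    ∙-closed : ∀ {x y} → H x → H y → H (x ∙ y)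
    ∙-closed = proj₁ (proj₂ (proj₂ H-sub))

    ⁻¹-closed : ∀ {x} → H x → H (x ⁻¹)
    ⁻¹-closed = proj₂ (proj₂ (proj₂ H-sub))

  ·-closed : (A C : Subset) → Closed (A · C)
  ·-closed _ _ x≈y (a , b , a∈ , b∈ , x≈ab) = a , b , a∈ , b∈ , trans (sym x≈y) x≈ab

  ·-mono : ∀ {A A′ C C′ : Subset} → A ⊆ A′ → C ⊆ C′ → (A · C) ⊆ (A′ · C′)
  ·-mono A⊆ C⊆ (a , b , a∈ , b∈ , x≈ab) = a , b , A⊆ a∈ , C⊆ b∈ , x≈ab

  ·-comm : ∀ {A C : Subset} → (A · C) ⊆ (C · A)
  ·-comm (a , b , a∈ , b∈ , x≈ab) = b , a , b∈ , a∈ , trans x≈ab (comm a b)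

  ·-isSubgroup : ∀ {H K : Subset} → IsSubgroup H → IsSubgroup K → IsSubgroup (H · K)
  ·-isSubgroup {H} {K} H-sub K-sub =
    ·-closed H K ,
    (ε , ε , H.ε-closed , K.ε-closed , sym (identityʳ ε)) ,
    (λ (a , b , a∈ , b∈ , x≈ab) (a′ , b′ , a′∈ , b′∈ , y≈ab′) →
       a ∙ a′ , b ∙ b′ , H.∙-closed a∈ a′∈ , K.∙-closed b∈ b′∈ ,
       trans (∙-cong x≈ab y≈ab′) (interchange a b a′ b′)) ,
    (λ (a , b , a∈ , b∈ , x≈ab) →
       a ⁻¹ , b ⁻¹ , H.⁻¹-closed a∈ , K.⁻¹-closed b∈ ,
       trans (⁻¹-cong x≈ab) (sym (⁻¹-∙-comm a b)))
    where
      module H = Subgroup H-sub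
      module K = Subgroup K-sub

  ·-⊆ : ∀ {H A C : Subset} → IsSubgroup H → A ⊆ H → C ⊆ H → (A · C) ⊆ H
  ·-⊆ H-sub A⊆ C⊆ (a , b , a∈ , b∈ , x≈ab) =
    Subgroup.≈-closed H-sub (sym x≈ab) (Subgroup.∙-closed H-sub (A⊆ a∈) (C⊆ b∈))

  ·-≐-comm : ∀ {H A C : Subset} → (A · C) ≐ H → (C · A) ≐ H
  ·-≐-comm (AC⊆H , H⊆AC) = (λ x∈ → AC⊆H (·-comm x∈)) , (λ x∈ → ·-comm (H⊆AC x∈))

  CoMinimalPair-sym : ∀ {H A C : Subset} → CoMinimalPair H A C → CoMinimalPair H C A
  CoMinimalPair-sym (A-sub , C-sub , A-ne , C-ne , AC≐H , minA , minC) =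
    C-sub , A-sub , C-ne , A-ne , ·-≐-comm AC≐H ,
    (λ c c∈ AC∖c≐H → minC c c∈ (·-≐-comm AC∖c≐H)) ,
    (λ a a∈ A∖aC≐H → minA a a∈ (·-≐-comm A∖aC≐H))

  CoMinimalPair-respˡ : ∀ {H A A′ C : Subset} → Closed A′ → A ≐ A′ →
                        CoMinimalPair H A C → CoMinimalPair H A′ C
  CoMinimalPair-respˡ A′-closed (A⊆A′ , A′⊆A)
                      ((_ , A⊆H) , C-sub , (a , a∈) , C-ne , (AC⊆ , ⊆AC) , minA , minC) =
    (A′-closed , λ x∈ → A⊆H (A′⊆A x∈)) , C-sub , (a , A⊆A′ a∈) , C-ne ,
    ((λ x∈ → AC⊆ (·-mono A′⊆A id x∈)) , (λ x∈ → ·-mono A⊆A′ id (⊆AC x∈))) ,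
    (λ a a∈ (_ , ⊆A′∖aC) → minA a (A′⊆A a∈)
       ( (λ x∈ → AC⊆ (·-mono proj₁ id x∈))
       , (λ x∈ → ·-mono (λ (y∈ , y≉a) → A′⊆A y∈ , y≉a) id (⊆A′∖aC x∈)))) ,
    (λ b b∈ (_ , ⊆A′C∖b) → minC b b∈
       ( (λ x∈ → AC⊆ (·-mono id proj₁ x∈))
       , (λ x∈ → ·-mono A′⊆A id (⊆A′C∖b x∈))))

  module DirectProduct {G₁ G₂ : Subset} (G₁-sub : IsSubgroup G₁) (G₂-sub : IsSubgroup G₂)
                       (injective : ProductInjective G₁ G₂) where
    private
      module G₁ = Subgroup G₁-sub
      module G₂ = Subgroup G₂-sub

    components : ∀ {g k a h m y} → G₁ g → G₂ k → G₁ a → G₂ h → G₁ m → G₂ y →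
                 g ∙ k ≈ (a ∙ h) ∙ (m ∙ y) → (g ≈ a ∙ m) × (k ≈ h ∙ y)
    components g∈ k∈ a∈ h∈ m∈ y∈ gk≈ahmy =
      injective g∈ (G₁.∙-closed a∈ m∈) k∈ (G₂.∙-closed h∈ y∈)
                (trans gk≈ahmy (interchange _ _ _ _))

    Graph-closed : ∀ {C : Subset} {v : Carrier → Carrier} → Closed (Graph C v)
    Graph-closed x≈y (m , m∈ , x≈mvm) = m , m∈ , trans (sym x≈y) x≈mvm

    Graph-⊆ : ∀ {C : Subset} {v : Carrier → Carrier} →
              C ⊆ G₁ → MapBetween G₁ G₂ v → Graph C v ⊆ (G₁ · G₂)
    Graph-⊆ C⊆ (v-map , _) (m , m∈ , x≈mvm) = m , _ , C⊆ m∈ , v-map (C⊆ m∈) , x≈mvm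

    ·-G₂-⊆ : ∀ {B : Subset} → B ⊆ G₁ → (B · G₂) ⊆ (G₁ · G₂)
    ·-G₂-⊆ B⊆ = ·-mono B⊆ id

    ·-G₂-Graph-⊆ : ∀ {B C : Subset} {v : Carrier → Carrier} → B ⊆ G₁ → C ⊆ G₁ →
                   MapBetween G₁ G₂ v → ((B · G₂) · Graph C v) ⊆ (G₁ · G₂)
    ·-G₂-Graph-⊆ B⊆ C⊆ v-map =
      ·-⊆ (·-isSubgroup G₁-sub G₂-sub) (·-G₂-⊆ B⊆) (Graph-⊆ C⊆ v-map)

    ·-G₂-Graph-covers : ∀ {B C : Subset} {v : Carrier → Carrier} → C ⊆ G₁ →
                        MapBetween G₁ G₂ v → G₁ ⊆ (B · C) →
                        (G₁ · G₂) ⊆ ((B · G₂) · Graph C v)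
    ·-G₂-Graph-covers {v = v} C⊆ (v-map , _) G₁⊆BC {x} (g , k , g∈ , k∈ , x≈gk)
      with G₁⊆BC g∈
    ... | b , c , b∈ , c∈ , g≈bc =
      b ∙ (k // v c) , c ∙ v c ,
      (b , k // v c , b∈ , G₂.∙-closed k∈ (G₂.⁻¹-closed (v-map (C⊆ c∈))) , refl) ,
      (c , c∈ , refl) ,
      (begin
        x                             ≈⟨ x≈gk ⟩
        g ∙ k                         ≈⟨ ∙-congʳ g≈bc ⟩
        (b ∙ c) ∙ k                   ≈⟨ ∙-congˡ (//-rightDividesˡ (v c) k) ⟨
        (b ∙ c) ∙ ((k // v c) ∙ v c)  ≈⟨ interchange b (k // v c) c (v c) ⟨
        (b ∙ (k // v c)) ∙ (c ∙ v c)  ∎)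

    module _ {B C : Subset} {v : Carrier → Carrier} (B-sub : SubsetOf G₁ B)
             (C-sub : SubsetOf G₁ C) (v-MapBetween : MapBetween G₁ G₂ v) where
      private
        B⊆ : B ⊆ G₁
        B⊆ = proj₂ B-sub

        C⊆ : C ⊆ G₁
        C⊆ = proj₂ C-sub

        v-map : ∀ {x} → G₁ x → G₂ (v x)
        v-map = proj₁ v-MapBetween

        v-cong : ∀ {x y} → G₁ x → G₁ y → x ≈ y → v x ≈ v y
        v-cong = proj₂ v-MapBetween

        ⊆-·-G₂ : B ⊆ (B · G₂)
        ⊆-·-G₂ {b} b∈ = b , ε , b∈ , G₂.ε-closed , sym (identityʳ b)

      ·-G₂-Graph-≐⁺ : (B · C) ≐ G₁ → ((B · G₂) · Graph C v) ≐ (G₁ · G₂)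
      ·-G₂-Graph-≐⁺ (_ , G₁⊆BC) =
        ·-G₂-Graph-⊆ B⊆ C⊆ v-MapBetween , ·-G₂-Graph-covers C⊆ v-MapBetween G₁⊆BC

      ·-G₂-Graph-≐⁻ : ((B · G₂) · Graph C v) ≐ (G₁ · G₂) → (B · C) ≐ G₁
      ·-G₂-Graph-≐⁻ (_ , G⊆) = ·-⊆ G₁-sub B⊆ C⊆ , G₁⊆BC
        where
          G₁⊆BC : G₁ ⊆ (B · C)
          G₁⊆BC {g} g∈
            with G⊆ (g , ε , g∈ , G₂.ε-closed , sym (identityʳ g))
          ... | _ , _ , (b , h , b∈ , h∈ , x≈bh) , (c , c∈ , y≈cvc) , g≈xy =
            b , c , b∈ , c∈ ,
            proj₁ (components g∈ G₂.ε-closed (B⊆ b∈) h∈ (C⊆ c∈) (v-map (C⊆ c∈))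
                              (trans (identityʳ g) (trans g≈xy (∙-cong x≈bh y≈cvc))))

      -- Factor gk for k = h v(g b⁻¹) through (BG₂ ∖ bh) Cᵥ: the G₁-part b′ ≠ b, since b′ = b
      -- would force the factor to be bh itself.
      ·-G₂-Graph-minimalˡ⁺ : (∀ b → B b → ¬ (((B ∖⟨ b ⟩) · C) ≐ G₁)) →
                            ∀ x → (B · G₂) x →
                            ¬ ((((B · G₂) ∖⟨ x ⟩) · Graph C v) ≐ (G₁ · G₂))
      ·-G₂-Graph-minimalˡ⁺ minB x (b , h , b∈ , h∈ , x≈bh) (_ , G⊆) =
        minB b b∈ (·-⊆ G₁-sub (λ (b′∈ , _) → B⊆ b′∈) C⊆ , G₁⊆B∖bC)
        where
          G₁⊆B∖bC : G₁ ⊆ ((B ∖⟨ b ⟩) · C)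
          G₁⊆B∖bC {g} g∈
            with G⊆ (g , h ∙ v (g // b) , g∈ ,
                     G₂.∙-closed h∈ (v-map (G₁.∙-closed g∈ (G₁.⁻¹-closed (B⊆ b∈)))) , refl)
          ... | x′ , _ , ((b′ , h′ , b′∈ , h′∈ , x′≈b′h′) , x′≉x) , (c′ , c′∈ , y≈c′vc′) , gk≈x′y =
            b′ , c′ , (b′∈ , b′≉b) , c′∈ , g≈b′c′
            where
              gb⁻¹∈ : G₁ (g // b)
              gb⁻¹∈ = G₁.∙-closed g∈ (G₁.⁻¹-closed (B⊆ b∈))

              split : (g ≈ b′ ∙ c′) × (h ∙ v (g // b) ≈ h′ ∙ v c′)
              split = components g∈ (G₂.∙-closed h∈ (v-map gb⁻¹∈)) (B⊆ b′∈) h′∈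
                                 (C⊆ c′∈) (v-map (C⊆ c′∈))
                                 (trans gk≈x′y (∙-cong x′≈b′h′ y≈c′vc′))
              g≈b′c′ : g ≈ b′ ∙ c′
              g≈b′c′ = proj₁ split

              b′≉b : ¬ (b′ ≈ b)
              b′≉b b′≈b = x′≉x (begin
                x′       ≈⟨ x′≈b′h′ ⟩
                b′ ∙ h′  ≈⟨ ∙-cong b′≈b h′≈h ⟩
                b ∙ h    ≈⟨ x≈bh ⟨
                x        ∎)
                where
                  c′≈gb⁻¹ : c′ ≈ g // b
                  c′≈gb⁻¹ = trans (x≈z//y c′ b′ g (trans (comm c′ b′) (sym g≈b′c′)))
                                  (∙-congˡ (⁻¹-cong b′≈b))
                  h′≈h : h′ ≈ h
                  h′≈h = ∙-cancelʳ (v c′) h′ h (begin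
                    h′ ∙ v c′        ≈⟨ proj₂ split ⟨
                    h ∙ v (g // b)   ≈⟨ ∙-congˡ (v-cong gb⁻¹∈ (C⊆ c′∈) (sym c′≈gb⁻¹)) ⟩
                    h ∙ v c′         ∎)

      ·-G₂-Graph-minimalʳ⁺ : (∀ c → C c → ¬ ((B · (C ∖⟨ c ⟩)) ≐ G₁)) →
                            ∀ y → Graph C v y →
                            ¬ (((B · G₂) · (Graph C v ∖⟨ y ⟩)) ≐ (G₁ · G₂))
      ·-G₂-Graph-minimalʳ⁺ minC y (c , c∈ , y≈cvc) (_ , G⊆) =
        minC c c∈ (·-⊆ G₁-sub B⊆ (λ (c′∈ , _) → C⊆ c′∈) , G₁⊆BC∖c)
        where
          G₁⊆BC∖c : G₁ ⊆ (B · (C ∖⟨ c ⟩))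
          G₁⊆BC∖c {g} g∈ with G⊆ (g , v c , g∈ , v-map (C⊆ c∈) , refl)
          ... | _ , y′ , (b′ , h′ , b′∈ , h′∈ , x≈b′h′) , ((c′ , c′∈ , y′≈c′vc′) , y′≉y) , gvc≈xy′ =
            b′ , c′ , b′∈ , (c′∈ , c′≉c) ,
            proj₁ (components g∈ (v-map (C⊆ c∈)) (B⊆ b′∈) h′∈ (C⊆ c′∈) (v-map (C⊆ c′∈))
                              (trans gvc≈xy′ (∙-cong x≈b′h′ y′≈c′vc′)))
            where
              c′≉c : ¬ (c′ ≈ c)
              c′≉c c′≈c = y′≉y (trans y′≈c′vc′
                (trans (∙-cong c′≈c (v-cong (C⊆ c′∈) (C⊆ c∈) c′≈c)) (sym y≈cvc)))

      ·-G₂-Graph-minimalˡ⁻ : (∀ x → (B · G₂) x →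
                               ¬ ((((B · G₂) ∖⟨ x ⟩) · Graph C v) ≐ (G₁ · G₂))) →
                             ∀ b → B b → ¬ (((B ∖⟨ b ⟩) · C) ≐ G₁)
      ·-G₂-Graph-minimalˡ⁻ minBG₂ b b∈ (_ , G₁⊆B∖bC) =
        minBG₂ b (⊆-·-G₂ b∈)
          ( (λ x∈ → ·-G₂-Graph-⊆ B⊆ C⊆ v-MapBetween (·-mono proj₁ id x∈))
          , (λ x∈ → ·-mono B∖b·G₂⊆ id (·-G₂-Graph-covers C⊆ v-MapBetween G₁⊆B∖bC x∈)))
        where
          B∖b·G₂⊆ : ((B ∖⟨ b ⟩) · G₂) ⊆ ((B · G₂) ∖⟨ b ⟩)
          B∖b·G₂⊆ (b′ , h , (b′∈ , b′≉b) , h∈ , x≈b′h) =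
            (b′ , h , b′∈ , h∈ , x≈b′h) ,
            λ x≈b → b′≉b (proj₁ (injective (B⊆ b′∈) (B⊆ b∈) h∈ G₂.ε-closed
                                           (trans (sym x≈b′h) (trans x≈b (sym (identityʳ b))))))

      ·-G₂-Graph-minimalʳ⁻ : (∀ y → Graph C v y →
                               ¬ (((B · G₂) · (Graph C v ∖⟨ y ⟩)) ≐ (G₁ · G₂))) →
                             ∀ c → C c → ¬ ((B · (C ∖⟨ c ⟩)) ≐ G₁)
      ·-G₂-Graph-minimalʳ⁻ minGraph c c∈ (_ , G₁⊆BC∖c) =
        minGraph (c ∙ v c) (c , c∈ , refl)
          ( (λ x∈ → ·-G₂-Graph-⊆ B⊆ C⊆ v-MapBetween (·-mono id proj₁ x∈))
          , (λ x∈ → ·-mono id Graph∖⊆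
                      (·-G₂-Graph-covers (λ (c′∈ , _) → C⊆ c′∈) v-MapBetween G₁⊆BC∖c x∈)))
        where
          Graph∖⊆ : Graph (C ∖⟨ c ⟩) v ⊆ (Graph C v ∖⟨ c ∙ v c ⟩)
          Graph∖⊆ (c′ , (c′∈ , c′≉c) , y≈c′vc′) =
            (c′ , c′∈ , y≈c′vc′) ,
            λ y≈cvc → c′≉c (proj₁ (injective (C⊆ c′∈) (C⊆ c∈) (v-map (C⊆ c′∈)) (v-map (C⊆ c∈))
                                             (trans (sym y≈c′vc′) y≈cvc)))

      ·-G₂-Graph-coMinimal⇔ :
        CoMinimalPair G₁ B C ⇔ CoMinimalPair (G₁ · G₂) (B · G₂) (Graph C v)
      ·-G₂-Graph-coMinimal⇔ = mk⇔
        (λ (_ , _ , (b , b∈) , (c , c∈) , BC≐ , minB , minC) →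
           (·-closed B G₂ , ·-G₂-⊆ B⊆) , (Graph-closed , Graph-⊆ C⊆ v-MapBetween) ,
           (b , ⊆-·-G₂ b∈) , (c ∙ v c , c , c∈ , refl) ,
           ·-G₂-Graph-≐⁺ BC≐ , ·-G₂-Graph-minimalˡ⁺ minB , ·-G₂-Graph-minimalʳ⁺ minC)
        (λ (_ , _ , (_ , b , _ , b∈ , _) , (_ , c , c∈ , _) , covers , minBG₂ , minGraph) →
           B-sub , C-sub , (b , b∈) , (c , c∈) ,
           ·-G₂-Graph-≐⁻ covers , ·-G₂-Graph-minimalˡ⁻ minBG₂ , ·-G₂-Graph-minimalʳ⁻ minGraph)

    spiked-cover⇒base-cover : ∀ {r} {u v : Carrier → Carrier} {φ : Carrier → Vec ℤ (suc r)}
                              {B M X : Subset} → IsIsoToℤ^ (suc r) G₂ φ → B ⊆ G₁ →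
                              MapBetween G₁ G₂ v → Moderation G₁ φ u v → M ⊆ G₁ →
                              (X ⊆ λ x → (B · G₂) x ⊎ Spikes G₁ G₂ u φ B x) →
                              (G₁ · G₂) ⊆ (X · Graph M v) → G₁ ⊆ (B · M)
    spiked-cover⇒base-cover {v = v} {φ} (φ-cong , φ-hom , _ , φ-onto) B⊆ (v-map , v-cong)
                            v-mod M⊆ X-spiked G⊆ {g} g∈
      with v-mod g g∈
    ... | bound , u+v≤bound with φ-onto bound
    ... | k , k∈ , φk≡bound with G⊆ (g , k , g∈ , k∈ , refl)
    ... | x , _ , x∈ , (m , m∈ , y≈mvm) , gk≈xy with X-spiked x∈
    ... | inj₁ (b , h , b∈ , h∈ , x≈bh) =
      b , m , b∈ , m∈ ,
      proj₁ (components g∈ k∈ (B⊆ b∈) h∈ (M⊆ m∈) (v-map (M⊆ m∈))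
                        (trans gk≈xy (∙-cong x≈bh y≈mvm)))
    ... | inj₂ (g₁ , h , g₁∈ , _ , h∈ , φh<φug₁ , x≈g₁h) =
      ⊥-elim (<ᵛ-irrefl (≡.subst (_<ᵛ bound) (≡.trans (≡.sym φk≡) φk≡bound)
                                 (+ᵛ-<ᵛ-≤ᵛ-trans φh<φug₁ (u+v≤bound g₁ g₁∈))))
      where
        split : (g ≈ g₁ ∙ m) × (k ≈ h ∙ v m)
        split = components g∈ k∈ g₁∈ h∈ (M⊆ m∈) (v-map (M⊆ m∈))
                           (trans gk≈xy (∙-cong x≈g₁h y≈mvm))

        m≈gg₁⁻¹ : m ≈ g // g₁
        m≈gg₁⁻¹ = x≈z//y m g₁ g (trans (comm m g₁) (sym (proj₁ split)))

        φk≡ : φ k ≡ φ h +ᵛ φ (v (g // g₁))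
        φk≡ = ≡.trans (φ-cong k∈ (G₂.∙-closed h∈ (v-map (M⊆ m∈))) (proj₂ split))
             (≡.trans (φ-hom h∈ (v-map (M⊆ m∈)))
                      (≡.cong (φ h +ᵛ_)
                              (φ-cong (v-map (M⊆ m∈)) (v-map gg₁⁻¹∈)
                                      (v-cong (M⊆ m∈) gg₁⁻¹∈ m≈gg₁⁻¹))))
          where
            gg₁⁻¹∈ : G₁ (g // g₁)
            gg₁⁻¹∈ = G₁.∙-closed g∈ (G₁.⁻¹-closed g₁∈)

    spiked-≐-base : ∀ {r} {u v : Carrier → Carrier} {φ : Carrier → Vec ℤ (suc r)}
                    {B M X : Subset} → IsIsoToℤ^ (suc r) G₂ φ → SubsetOf G₁ B →
                    MapBetween G₁ G₂ v → Moderation G₁ φ u v → M ⊆ G₁ →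
                    (B · G₂) ⊆ X → (X ⊆ λ x → (B · G₂) x ⊎ Spikes G₁ G₂ u φ B x) →
                    CoMinimalPair (G₁ · G₂) X (Graph M v) → X ≐ (B · G₂)
    spiked-≐-base {v = v} {B = B} {M} {X} φ-iso (B-closed , B⊆) v-MapBetween v-mod M⊆
                  BG₂⊆X X-spiked
                  (_ , _ , _ , _ , (XG⊆ , G⊆XG) , minX , _) = X⊆BG₂ , BG₂⊆X
      where
        X⊆BG₂ : X ⊆ (B · G₂)
        X⊆BG₂ {x} x∈ with X-spiked x∈
        ... | inj₁ x∈BG₂ = x∈BG₂
        ... | inj₂ (g₁ , h , g₁∈ , g₁∉B , h∈ , _ , x≈g₁h) =
          ⊥-elim (minX x x∈ (X∖x·Graph⊆G , G⊆X∖x·Graph))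
          where
            BG₂⊆X∖x : (B · G₂) ⊆ (X ∖⟨ x ⟩)
            BG₂⊆X∖x y∈@(b , h′ , b∈ , h′∈ , y≈bh′) =
              BG₂⊆X y∈ ,
              λ y≈x → g₁∉B (B-closed (proj₁ (injective (B⊆ b∈) g₁∈ h′∈ h∈
                                            (trans (sym y≈bh′) (trans y≈x x≈g₁h)))) b∈)

            X∖x·Graph⊆G : ((X ∖⟨ x ⟩) · Graph M v) ⊆ (G₁ · G₂)
            X∖x·Graph⊆G y∈ = XG⊆ (·-mono proj₁ id y∈)

            G⊆X∖x·Graph : (G₁ · G₂) ⊆ ((X ∖⟨ x ⟩) · Graph M v)
            G⊆X∖x·Graph y∈ =
              ·-mono BG₂⊆X∖x id
                (·-G₂-Graph-covers M⊆ v-MapBetween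
                   (spiked-cover⇒base-cover φ-iso B⊆ v-MapBetween v-mod M⊆ X-spiked G⊆XG) y∈)

theorem4p3 : ∀ {c ℓ : Level} (𝒢 : AbelianGroup c ℓ) → let open GroupDefs 𝒢 in
    (G₁ G₂ : Subset) → IsSubgroup G₁ → IsSubgroup G₂ →
    (r : ℕ) → 0 < r →
    ProductInjective G₁ G₂ →
    (u : Carrier → Carrier) → MapBetween G₁ G₂ u →
    (φ : Carrier → Vec ℤ r) → IsIsoToℤ^ r G₂ φ →
    (B : Subset) → SubsetOf G₁ B → NonEmpty B →
    (X : Subset) → BoundedSpikedSubset G₁ G₂ u φ B X →
    (∃[ w ] MapBetween G₁ G₂ w × Moderation G₁ φ u w) →
    ((∃[ v ] ∃[ M ] MapBetween G₁ G₂ v × Moderation G₁ φ u v × SubsetOf G₁ M ×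
        CoMinimalPair (G₁ · G₂) X (Graph M v))
     ⇔ ((X ≐ (B · G₂)) × PartOfCoMinimalPair G₁ B))
theorem4p3 𝒢 G₁ G₂ G₁-sub G₂-sub (suc r) _ injective u _ φ φ-iso B B-sub _ X
           (X-closed , BG₂⊆X , X-spiked) (w , w-map , w-mod) =
  mk⇔
    (λ (v , M , v-map , v-mod , M-sub , pair) →
       let X≐BG₂ = spiked-≐-base φ-iso B-sub v-map v-mod (proj₂ M-sub) BG₂⊆X X-spiked pair
       in X≐BG₂ , M , M-sub , inj₁ (descend X≐BG₂ M-sub v-map pair))
    (λ { (X≐BG₂ , C , C-sub , inj₁ pair) →
           w , C , w-map , w-mod , C-sub , lift X≐BG₂ C-sub pair
       ; (X≐BG₂ , C , C-sub , inj₂ pair) →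
           w , C , w-map , w-mod , C-sub , lift X≐BG₂ C-sub (CoMinimalPair-sym 𝒢 pair) })
  where
    open GroupDefs 𝒢
    open DirectProduct 𝒢 G₁-sub G₂-sub injective

    descend : ∀ {M v} → X ≐ (B · G₂) → SubsetOf G₁ M → MapBetween G₁ G₂ v →
              CoMinimalPair (G₁ · G₂) X (Graph M v) → CoMinimalPair G₁ B M
    descend X≐BG₂ M-sub v-map pair =
      Equivalence.from (·-G₂-Graph-coMinimal⇔ B-sub M-sub v-map)
        (CoMinimalPair-respˡ 𝒢 (·-closed 𝒢 B G₂) X≐BG₂ pair)

    lift : ∀ {C} → X ≐ (B · G₂) → SubsetOf G₁ C → CoMinimalPair G₁ B C →
           CoMinimalPair (G₁ · G₂) X (Graph C w)
    lift X≐BG₂ C-sub pair =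
      CoMinimalPair-respˡ 𝒢 X-closed (≐-sym X≐BG₂)
        (Equivalence.to (·-G₂-Graph-coMinimal⇔ B-sub C-sub w-map) pair)
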